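{- For each $\epsilon>0$ there exists $\delta>0$ such that the following holds. Let $k,n$ satisfy $\frac{k}{n}<\delta$, let $q\in[\epsilon,1)$, and let $\mathcal{F}\subseteq\binom{[n]}{k}$ be any family. Then the function $f_{\mathcal{F}}$ is $\left(\lceil1/\epsilon\rceil,\epsilon,\mu_q\right)$-regular.
   Context: Identify $x\in\{0,1\}^n$ with $\{i:x_i=1\}$, $|x|$ its size. $\mu_q$ is the $q$-biased product measure, $\mu_q(f)=\mathbb{E}_{\mu_q}[f]$. $f_{\mathcal{F}}(x)=0$ if $|x|<k$ and $f_{\mathcal{F}}(x)=\Pr_{\mathbf{A}\sim\binom{x}{k}}[\mathbf{A}\in\mathcal{F}]$ (uniform $k$-subset of $x$) if $|x|\ge k$. For $J\subseteq[n]$ and $y\in\{0,1\}^J$, $f_{J\to y}$ is the restriction of $f$ fixing the coordinates in $J$ to $y$, a function on $\{0,1\}^{[n]\setminus J}$. A function $f$ is $(r,\epsilon,\mu_q)$-regular if $|\mu_q(f_{J\to y})-\mu_q(f)|<\epsilon$ for all $J$ with $|J|\le r$ and all $y\in\{0,1\}^J$.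
   Formalization: The parameters ε and q are rational, and the witness δ is taken in the rationals. -}

module Defs where

open import Data.Bool using (Bool; true; false; T)
open import Data.Nat as ℕ using (ℕ; zero; suc)
open import Data.Nat.Combinatorics using (_C_)
open import Data.Integer using (+_)
open import Data.Rational using (ℚ; 0ℚ; 1ℚ; _+_; _*_; _-_; _/_)
open import Data.Vec using (Vec; []; _∷_)
open import Data.List using (List; []; _∷_; map; _++_; length; filter)
open import Data.Fin.Subset using (Subset; _⊆_; ∣_∣)
open import Data.Fin.Subset.Properties using (_⊆?_)
open import Relation.Nullary using (yes; no)
open import Relation.Nullary.Decidable using (_×-dec_; T?)

allSubsets : (n : ℕ) → List (Subset n)
allSubsets zero = [] ∷ []
allSubsets (suc n) = map (true ∷_) (allSubsets n) ++ map (false ∷_) (allSubsets n)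

IsFamily : (n k : ℕ) → (Subset n → Bool) → Set
IsFamily n k F = ∀ A → T (F A) → ∣ A ∣ ≡ k
  where open import Relation.Binary.PropositionalEquality using (_≡_)

countIn : {n : ℕ} (k : ℕ) (F : Subset n → Bool) (x : Subset n) → ℕ
countIn {n} k F x =
  length (filter (λ A → (A ⊆? x) ×-dec ((∣ A ∣ ℕ.≟ k) ×-dec T? (F A))) (allSubsets n))

fF : {n : ℕ} (k : ℕ) (F : Subset n → Bool) → Subset n → ℚ
fF k F x with ∣ x ∣ ℕ.<? k
... | yes _ = 0ℚ
... | no _ with ∣ x ∣ C k
...   | zero = 0ℚ          -- unreachable: (|x| choose k) > 0 when |x| ≥ k
...   | suc m = (+ countIn k F x) / suc m

-- Expectation under the q-biased product measure of the restriction f_{J→y}: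
-- coordinates i ∈ J are fixed to y_i, the remaining coordinates are i.i.d.
-- with Pr[x_i = 1] = q.  (Only the values of y on J matter.)
-- μRestr q J y f = μ_q(f_{J→y}).
μRestr : {n : ℕ} (q : ℚ) (J y : Subset n) → (Subset n → ℚ) → ℚ
μRestr {zero} q [] [] f = f []
μRestr {suc n} q (true ∷ J) (b ∷ y) f = μRestr q J y (λ x → f (b ∷ x))
μRestr {suc n} q (false ∷ J) (_ ∷ y) f =
  q * μRestr q J y (λ x → f (true ∷ x)) + (1ℚ - q) * μRestr q J y (λ x → f (false ∷ x))

μ : {n : ℕ} (q : ℚ) → (Subset n → ℚ) → ℚ
μ {n} q f = μRestr q (Data.Fin.Subset.⊥) (Data.Fin.Subset.⊥) f
  where import Data.Fin.Subset

open import Data.Integer as ℤ using (ℤ)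
open import Data.Rational as Q using ()

Regular : {n : ℕ} (r : ℤ) (ε q : ℚ) → (Subset n → ℚ) → Set
Regular {n} r ε q f =
  (J : Subset n) → (+ ∣ J ∣) ℤ.≤ r → (y : Subset n) →
  Q.∣ μRestr q J y f - μ q f ∣ Q.< ε

module Submission where

-- Undo the restriction one fixed coordinate at a time. Fixing a coordinate moves the
-- μ_q-mean by at most the mean influence of that coordinate, and for f_𝓕 the edge
-- x ⊂ x ∪ {i} has influence at most k/(|x|+1): the k-subsets of x ∪ {i} that are not
-- subsets of x all contain i, a k/(|x|+1) share of all of them. Under μ_q the n - |J|
-- free coordinates make |x| about q(n - |J|), and a convexity estimate for 1/(1+|x|)
-- bounds the mean influence by k/(q(n - |J|)/2 + 1). Summed over |J| ≤ ⌈1/ε⌉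
-- coordinates this stays below ε as soon as k < ε³n/8.

open import Defs
open import Data.Bool using (Bool)
open import Data.Nat using (ℕ; NonZero)
open import Data.Integer using (+_)
open import Data.Product using (Σ; _×_)
open import Data.Rational using (ℚ; Positive; 1ℚ; _/_; _<_; _≤_; 1/_; ceiling)
open import Data.Rational.Properties using (pos⇒nonZero)
open import Data.Fin.Subset using (Subset)

open import Data.Bool using (true; false; if_then_else_)
open import Data.Bool.Properties using (∧-zeroʳ)
open import Data.Fin using (zero; suc)
open import Data.Fin.Subset using (∣_∣; ⊥; ∁)
open import Data.Fin.Subset.Properties using (_⊆?_; ∣p∣≤n; ∣∁p∣≡n∸∣p∣)
import Data.Integer as ℤ
open import Data.Integer.DivMod using (a≡a%n+[a/n]*n; n%d<d)
import Data.Integer.Properties as ℤₚ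
open import Data.Integer.Tactic.RingSolver using () renaming (solve-∀ to ℤ-solve-∀)
open import Data.List using ([]; _∷_; map; _++_; length; filter)
open import Data.List.Properties using (length-++; filter-++)
open import Data.Maybe using (Maybe)
open import Data.Nat as ℕ using (zero; suc)
open import Data.Nat.Combinatorics using (_C_; nCk+nC[k+1]≡[n+1]C[k+1])
import Data.Nat.Properties as ℕₚ
open import Data.Nat.Tactic.RingSolver using () renaming (solve-∀ to ℕ-solve-∀)
open import Data.Product using (_,_; proj₁; proj₂)
open import Data.Rational as ℚ using (0ℚ; ½; _+_; _*_; _-_; -_)
import Data.Rational.Properties as ℚₚ
open import Data.Rational.Unnormalised as ℚᵘ using (mkℚᵘ; *≡*)
import Data.Rational.Unnormalised.Properties as ℚᵘₚ
open import Data.Sum using (inj₁; inj₂)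
open import Data.Vec using ([]; _∷_; _[_]≔_)
open import Function using (_∘_)
open import Level using (0ℓ)
open import Relation.Binary using (Tri; tri<; tri≈; tri>)
open import Relation.Binary.PropositionalEquality
open import Relation.Nullary using (does; yes; no; contradiction)
open import Relation.Nullary.Decidable using (_×-dec_; T?; dec⇒maybe)
open import Relation.Unary using (Pred; Decidable)
open import Tactic.RingSolver using (solve-∀)
import Tactic.RingSolver.Core.AlmostCommutativeRing as ACR

ℚ-ring : ACR.AlmostCommutativeRing 0ℓ 0ℓ
ℚ-ring = ACR.fromCommutativeRing ℚₚ.+-*-commutativeRing 0≟
  where
  0≟ : ∀ x → Maybe (0ℚ ≡ x)
  0≟ x = dec⇒maybe (0ℚ ℚₚ.≟ x)

*-monoˡ-≤-≥0 : ∀ {r p q} → 0ℚ ≤ r → p ≤ q → r * p ≤ r * q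
*-monoˡ-≤-≥0 {r} 0≤r = ℚₚ.*-monoˡ-≤-nonNeg r {{ℚ.nonNegative 0≤r}}

*-monoʳ-≤-≥0 : ∀ {r p q} → 0ℚ ≤ r → p ≤ q → p * r ≤ q * r
*-monoʳ-≤-≥0 {r} 0≤r = ℚₚ.*-monoʳ-≤-nonNeg r {{ℚ.nonNegative 0≤r}}

0≤*  : ∀ {p q} → 0ℚ ≤ p → 0ℚ ≤ q → 0ℚ ≤ p * q
0≤* {p} 0≤p 0≤q = subst (_≤ p * _) (ℚₚ.*-zeroʳ p) (*-monoˡ-≤-≥0 0≤p 0≤q)

0≤+ : ∀ {p q} → 0ℚ ≤ p → 0ℚ ≤ q → 0ℚ ≤ p + q
0≤+ = ℚₚ.+-mono-≤

0≤1 : 0ℚ ≤ 1ℚ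
0≤1 = ℚₚ.nonNegative⁻¹ 1ℚ

0≤½ : 0ℚ ≤ ½
0≤½ = ℚₚ.nonNegative⁻¹ ½

p≤q⇒0≤q-p : ∀ {p q} → p ≤ q → 0ℚ ≤ q - p
p≤q⇒0≤q-p {p} {q} p≤q = subst (_≤ q - p) (ℚₚ.+-inverseʳ p) (ℚₚ.+-monoˡ-≤ (- p) p≤q)

0≤q-p⇒p≤q : ∀ {p q} → 0ℚ ≤ q - p → p ≤ q
0≤q-p⇒p≤q {p} {q} 0≤q-p = subst₂ _≤_ (ℚₚ.+-identityˡ p) (cancel p q) (ℚₚ.+-monoˡ-≤ p 0≤q-p)
  where
  cancel : ∀ p q → q - p + p ≡ q
  cancel = solve-∀ ℚ-ring

toℚ : ℕ → ℚ
toℚ zero = 0ℚ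
toℚ (suc m) = 1ℚ + toℚ m

0≤toℚ : ∀ m → 0ℚ ≤ toℚ m
0≤toℚ zero = ℚₚ.≤-refl
0≤toℚ (suc m) = 0≤+ 0≤1 (0≤toℚ m)

1≤toℚ-suc : ∀ m → 1ℚ ≤ toℚ (suc m)
1≤toℚ-suc m = subst (_≤ toℚ (suc m)) (ℚₚ.+-identityʳ 1ℚ) (ℚₚ.+-monoʳ-≤ 1ℚ (0≤toℚ m))

toℚ-suc-pos : ∀ m → 0ℚ < toℚ (suc m)
toℚ-suc-pos m = ℚₚ.<-≤-trans (ℚₚ.positive⁻¹ 1ℚ) (1≤toℚ-suc m)

toℚ-mono-≤ : ∀ {m n} → m ℕ.≤ n → toℚ m ≤ toℚ n
toℚ-mono-≤ {zero} {n} _ = 0≤toℚ n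
toℚ-mono-≤ {suc m} {suc n} (ℕ.s≤s m≤n) = ℚₚ.+-monoʳ-≤ 1ℚ (toℚ-mono-≤ m≤n)

toℚ-+ : ∀ m n → toℚ (m ℕ.+ n) ≡ toℚ m + toℚ n
toℚ-+ zero n = sym (ℚₚ.+-identityˡ (toℚ n))
toℚ-+ (suc m) n = trans (cong (λ x → 1ℚ + x) (toℚ-+ m n)) (sym (ℚₚ.+-assoc 1ℚ (toℚ m) (toℚ n)))

toℚ-* : ∀ m n → toℚ (m ℕ.* n) ≡ toℚ m * toℚ n
toℚ-* zero n = sym (ℚₚ.*-zeroˡ (toℚ n))
toℚ-* (suc m) n = begin-equality
  toℚ (n ℕ.+ m ℕ.* n)       ≡⟨ toℚ-+ n (m ℕ.* n) ⟩
  toℚ n + toℚ (m ℕ.* n)     ≡⟨ cong (λ x → toℚ n + x) (toℚ-* m n) ⟩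
  toℚ n + toℚ m * toℚ n     ≡⟨ distrib (toℚ m) (toℚ n) ⟩
  (1ℚ + toℚ m) * toℚ n      ∎
  where
  open ℚₚ.≤-Reasoning
  distrib : ∀ a b → b + a * b ≡ (1ℚ + a) * b
  distrib = solve-∀ ℚ-ring

1/[1+_] : ℕ → ℚ
1/[1+ m ] = (1/ toℚ (suc m)) {{ℚ.>-nonZero (toℚ-suc-pos m)}}

toℚ-suc*1/[1+]≡1 : ∀ m → toℚ (suc m) * 1/[1+ m ] ≡ 1ℚ
toℚ-suc*1/[1+]≡1 m = ℚₚ.*-inverseʳ (toℚ (suc m)) {{ℚ.>-nonZero (toℚ-suc-pos m)}}

0≤1/[1+] : ∀ m → 0ℚ ≤ 1/[1+ m ]
0≤1/[1+] m = ℚₚ.nonNegative⁻¹ 1/[1+ m ]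
  {{ℚₚ.pos⇒nonNeg 1/[1+ m ] {{ℚₚ.1/pos⇒pos (toℚ (suc m)) {{ℚ.positive (toℚ-suc-pos m)}}}}}}

1/[1+]-antimono : ∀ {m n} → m ℕ.≤ n → 1/[1+ n ] ≤ 1/[1+ m ]
1/[1+]-antimono {m} {n} m≤n = begin
  1/[1+ n ]                                   ≡⟨ cancel 1/[1+ n ] (toℚ-suc*1/[1+]≡1 m) ⟨
  1/[1+ n ] * (toℚ (suc m) * 1/[1+ m ])       ≤⟨ *-monoˡ-≤-≥0 (0≤1/[1+] n)
                                                   (*-monoʳ-≤-≥0 (0≤1/[1+] m) (toℚ-mono-≤ (ℕ.s≤s m≤n))) ⟩
  1/[1+ n ] * (toℚ (suc n) * 1/[1+ m ])       ≡⟨ swap 1/[1+ n ] (toℚ (suc n)) 1/[1+ m ] ⟩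
  (toℚ (suc n) * 1/[1+ n ]) * 1/[1+ m ]       ≡⟨ cong (_* 1/[1+ m ]) (toℚ-suc*1/[1+]≡1 n) ⟩
  1ℚ * 1/[1+ m ]                              ≡⟨ ℚₚ.*-identityˡ 1/[1+ m ] ⟩
  1/[1+ m ]                                   ∎
  where
  open ℚₚ.≤-Reasoning
  cancel : ∀ a {b} → b ≡ 1ℚ → a * b ≡ a
  cancel a refl = ℚₚ.*-identityʳ a
  swap : ∀ a b c → a * (b * c) ≡ (b * a) * c
  swap = solve-∀ ℚ-ring

-- (+ a) / suc b is normalised by a gcd computation, so it is compared with
-- toℚ a * 1/[1+ b ] through the unnormalised rationals.
toℚᵘ-toℚ : ∀ m → ℚ.toℚᵘ (toℚ m) ℚᵘ.≃ mkℚᵘ (+ m) 0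
toℚᵘ-toℚ zero = ℚᵘₚ.≃-refl
toℚᵘ-toℚ (suc m) = begin-equality
  ℚ.toℚᵘ (1ℚ + toℚ m)                 ≃⟨ ℚₚ.toℚᵘ-homo-+ 1ℚ (toℚ m) ⟩
  ℚᵘ.1ℚᵘ ℚᵘ.+ ℚ.toℚᵘ (toℚ m)          ≃⟨ ℚᵘₚ.+-congʳ ℚᵘ.1ℚᵘ (toℚᵘ-toℚ m) ⟩
  ℚᵘ.1ℚᵘ ℚᵘ.+ mkℚᵘ (+ m) 0            ≃⟨ *≡* (1+m*1≡[1+m]*1 (+ m)) ⟩
  mkℚᵘ (+ suc m) 0                    ∎
  where
  open ℚᵘₚ.≤-Reasoning
  1+m*1≡[1+m]*1 : ∀ m → (ℤ.1ℤ ℤ.+ m ℤ.* ℤ.1ℤ) ℤ.* ℤ.1ℤ ≡ (ℤ.1ℤ ℤ.+ m) ℤ.* ℤ.1ℤ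
  1+m*1≡[1+m]*1 = ℤ-solve-∀

+a/[1+b]*toℚ[1+b]≡toℚa : ∀ a b → + a / suc b * toℚ (suc b) ≡ toℚ a
+a/[1+b]*toℚ[1+b]≡toℚa a b = ℚₚ.toℚᵘ-injective (begin-equality
  ℚ.toℚᵘ (+ a / suc b * toℚ (suc b))               ≃⟨ ℚₚ.toℚᵘ-homo-* (+ a / suc b) (toℚ (suc b)) ⟩
  ℚ.toℚᵘ (+ a / suc b) ℚᵘ.* ℚ.toℚᵘ (toℚ (suc b))   ≃⟨ ℚᵘₚ.*-cong (ℚₚ.toℚᵘ-fromℚᵘ (mkℚᵘ (+ a) b)) (toℚᵘ-toℚ (suc b)) ⟩
  mkℚᵘ (+ a) b ℚᵘ.* mkℚᵘ (+ suc b) 0               ≃⟨ *≡* (trans (ℤₚ.*-identityʳ _) (cong (λ d → + a ℤ.* + d) (sym (ℕₚ.*-identityʳ (suc b))))) ⟩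
  mkℚᵘ (+ a) 0                                     ≃⟨ toℚᵘ-toℚ a ⟨
  ℚ.toℚᵘ (toℚ a)                                   ∎)
  where open ℚᵘₚ.≤-Reasoning

+a/[1+b]≡toℚa*1/[1+b] : ∀ a b → (+ a) / suc b ≡ toℚ a * 1/[1+ b ]
+a/[1+b]≡toℚa*1/[1+b] a b = begin-equality
  + a / suc b                                   ≡⟨ ℚₚ.*-identityʳ _ ⟨
  + a / suc b * 1ℚ                              ≡⟨ cong (+ a / suc b *_) (toℚ-suc*1/[1+]≡1 b) ⟨
  + a / suc b * (toℚ (suc b) * 1/[1+ b ])       ≡⟨ ℚₚ.*-assoc (+ a / suc b) (toℚ (suc b)) 1/[1+ b ] ⟨
  + a / suc b * toℚ (suc b) * 1/[1+ b ]         ≡⟨ cong (_* 1/[1+ b ]) (+a/[1+b]*toℚ[1+b]≡toℚa a b) ⟩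
  toℚ a * 1/[1+ b ]                             ∎
  where open ℚₚ.≤-Reasoning

∣p*q∣≡p*∣q∣ : ∀ {p} q → 0ℚ ≤ p → ℚ.∣ p * q ∣ ≡ p * ℚ.∣ q ∣
∣p*q∣≡p*∣q∣ {p} q 0≤p = trans (ℚₚ.∣p*q∣≡∣p∣*∣q∣ p q) (cong (_* ℚ.∣ q ∣) (ℚₚ.0≤p⇒∣p∣≡p 0≤p))

∣t*p∣≤∣p∣ : ∀ {t} p → 0ℚ ≤ t → t ≤ 1ℚ → ℚ.∣ t * p ∣ ≤ ℚ.∣ p ∣
∣t*p∣≤∣p∣ {t} p 0≤t t≤1 = begin
  ℚ.∣ t * p ∣   ≡⟨ ∣p*q∣≡p*∣q∣ p 0≤t ⟩
  t * ℚ.∣ p ∣   ≤⟨ *-monoʳ-≤-≥0 (ℚₚ.0≤∣p∣ p) t≤1 ⟩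
  1ℚ * ℚ.∣ p ∣  ≡⟨ ℚₚ.*-identityˡ ℚ.∣ p ∣ ⟩
  ℚ.∣ p ∣       ∎
  where open ℚₚ.≤-Reasoning

∣p-r∣≤∣p-q∣+∣q-r∣ : ∀ p q r → ℚ.∣ p - r ∣ ≤ ℚ.∣ p - q ∣ + ℚ.∣ q - r ∣
∣p-r∣≤∣p-q∣+∣q-r∣ p q r = subst (λ d → ℚ.∣ d ∣ ≤ ℚ.∣ p - q ∣ + ℚ.∣ q - r ∣) (telescope p q r) (ℚₚ.∣p+q∣≤∣p∣+∣q∣ (p - q) (q - r))
  where
  telescope : ∀ p q r → (p - q) + (q - r) ≡ p - r
  telescope = solve-∀ ℚ-ring

∣p-q∣≤r : ∀ {p q r} → p ≤ q + r → q ≤ p + r → ℚ.∣ p - q ∣ ≤ r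
∣p-q∣≤r {p} {q} {r} p≤q+r q≤p+r with ℚₚ.∣p∣≡p∨∣p∣≡-p (p - q)
... | inj₁ ∣d∣≡d = subst (_≤ r) (sym ∣d∣≡d) (subst (p - q ≤_) (cancel q r) (ℚₚ.+-monoˡ-≤ (- q) p≤q+r))
  where
  cancel : ∀ q r → q + r - q ≡ r
  cancel = solve-∀ ℚ-ring
... | inj₂ ∣d∣≡-d = subst (_≤ r) (sym ∣d∣≡-d) (subst₂ _≤_ (cancel p q) (cancel′ p r) (ℚₚ.+-monoˡ-≤ (- p) q≤p+r))
  where
  cancel : ∀ p q → q - p ≡ - (p - q)
  cancel = solve-∀ ℚ-ring
  cancel′ : ∀ p r → p + r - p ≡ r
  cancel′ = solve-∀ ℚ-ring

mix-distrib-sub : ∀ q a₁ b₁ a₀ b₀ →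
  q * (a₁ - b₁) + (1ℚ - q) * (a₀ - b₀) ≡ (q * a₁ + (1ℚ - q) * a₀) - (q * b₁ + (1ℚ - q) * b₀)
mix-distrib-sub = solve-∀ ℚ-ring

mix-distrib-*ˡ : ∀ q c a b → q * (c * a) + (1ℚ - q) * (c * b) ≡ c * (q * a + (1ℚ - q) * b)
mix-distrib-*ˡ = solve-∀ ℚ-ring

Antitone : (ℕ → ℚ) → Set
Antitone W = ∀ m → W (suc m) ≤ W m

InfluenceBound : ∀ {n} → (ℕ → ℚ) → (Subset n → ℚ) → Set
InfluenceBound W f = ∀ x i → ℚ.∣ f (x [ i ]≔ true) - f (x [ i ]≔ false) ∣ ≤ W ∣ x [ i ]≔ false ∣

module _ {q : ℚ} where

  open ℚₚ.≤-Reasoning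

  μRestr-cong : ∀ {n} (J y : Subset n) {f g : Subset n → ℚ} → (∀ x → f x ≡ g x) →
                μRestr q J y f ≡ μRestr q J y g
  μRestr-cong [] [] f≗g = f≗g []
  μRestr-cong (true ∷ J) (b ∷ y) f≗g = μRestr-cong J y (λ x → f≗g (b ∷ x))
  μRestr-cong (false ∷ J) (_ ∷ y) f≗g =
    cong₂ (λ a b → q * a + (1ℚ - q) * b) (μRestr-cong J y (λ x → f≗g (true ∷ x)))
                                         (μRestr-cong J y (λ x → f≗g (false ∷ x)))

  μRestr-- : ∀ {n} (J y : Subset n) (f g : Subset n → ℚ) →
             μRestr q J y (λ x → f x - g x) ≡ μRestr q J y f - μRestr q J y g
  μRestr-- [] [] f g = refl
  μRestr-- (true ∷ J) (b ∷ y) f g = μRestr-- J y _ _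
  μRestr-- (false ∷ J) (_ ∷ y) f g = begin-equality
    q * μRestr q J y (λ x → f (true ∷ x) - g (true ∷ x)) + (1ℚ - q) * μRestr q J y (λ x → f (false ∷ x) - g (false ∷ x))
      ≡⟨ cong₂ (λ a b → q * a + (1ℚ - q) * b) (μRestr-- J y _ _) (μRestr-- J y _ _) ⟩
    q * (f₁ - g₁) + (1ℚ - q) * (f₀ - g₀)
      ≡⟨ mix-distrib-sub q f₁ g₁ f₀ g₀ ⟩
    (q * f₁ + (1ℚ - q) * f₀) - (q * g₁ + (1ℚ - q) * g₀)
      ∎
    where
    f₁ = μRestr q J y (λ x → f (true ∷ x))
    f₀ = μRestr q J y (λ x → f (false ∷ x))
    g₁ = μRestr q J y (λ x → g (true ∷ x))
    g₀ = μRestr q J y (λ x → g (false ∷ x))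

  μRestr-*ˡ : ∀ {n} (J y : Subset n) c (f : Subset n → ℚ) →
              μRestr q J y (λ x → c * f x) ≡ c * μRestr q J y f
  μRestr-*ˡ [] [] c f = refl
  μRestr-*ˡ (true ∷ J) (b ∷ y) c f = μRestr-*ˡ J y c _
  μRestr-*ˡ (false ∷ J) (_ ∷ y) c f = trans
    (cong₂ (λ a b → q * a + (1ℚ - q) * b) (μRestr-*ˡ J y c _) (μRestr-*ˡ J y c _))
    (mix-distrib-*ˡ q c _ _)

module _ {q : ℚ} (0≤q : 0ℚ ≤ q) (q≤1 : q ≤ 1ℚ) where

  open ℚₚ.≤-Reasoning

  ∣mix∣≤mix∣∣ : ∀ a b → ℚ.∣ q * a + (1ℚ - q) * b ∣ ≤ q * ℚ.∣ a ∣ + (1ℚ - q) * ℚ.∣ b ∣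
  ∣mix∣≤mix∣∣ a b = begin
    ℚ.∣ q * a + (1ℚ - q) * b ∣               ≤⟨ ℚₚ.∣p+q∣≤∣p∣+∣q∣ (q * a) ((1ℚ - q) * b) ⟩
    ℚ.∣ q * a ∣ + ℚ.∣ (1ℚ - q) * b ∣           ≡⟨ cong₂ _+_ (∣p*q∣≡p*∣q∣ a 0≤q) (∣p*q∣≡p*∣q∣ b (p≤q⇒0≤q-p q≤1)) ⟩
    q * ℚ.∣ a ∣ + (1ℚ - q) * ℚ.∣ b ∣           ∎

  mix-mono-≤ : ∀ {a₁ b₁ a₀ b₀} → a₁ ≤ b₁ → a₀ ≤ b₀ → q * a₁ + (1ℚ - q) * a₀ ≤ q * b₁ + (1ℚ - q) * b₀
  mix-mono-≤ a₁≤b₁ a₀≤b₀ = ℚₚ.+-mono-≤ (*-monoˡ-≤-≥0 0≤q a₁≤b₁) (*-monoˡ-≤-≥0 (p≤q⇒0≤q-p q≤1) a₀≤b₀)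

  μRestr-mono : ∀ {n} (J y : Subset n) {f g : Subset n → ℚ} → (∀ x → f x ≤ g x) →
                μRestr q J y f ≤ μRestr q J y g
  μRestr-mono [] [] f≤g = f≤g []
  μRestr-mono (true ∷ J) (b ∷ y) f≤g = μRestr-mono J y (λ x → f≤g (b ∷ x))
  μRestr-mono (false ∷ J) (_ ∷ y) f≤g =
    mix-mono-≤ (μRestr-mono J y (λ x → f≤g (true ∷ x))) (μRestr-mono J y (λ x → f≤g (false ∷ x)))

  ∣μRestr∣≤μRestr∣∣ : ∀ {n} (J y : Subset n) (f : Subset n → ℚ) →
                      ℚ.∣ μRestr q J y f ∣ ≤ μRestr q J y (ℚ.∣_∣ ∘ f)
  ∣μRestr∣≤μRestr∣∣ [] [] f = ℚₚ.≤-refl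
  ∣μRestr∣≤μRestr∣∣ (true ∷ J) (b ∷ y) f = ∣μRestr∣≤μRestr∣∣ J y _
  ∣μRestr∣≤μRestr∣∣ (false ∷ J) (_ ∷ y) f = ℚₚ.≤-trans (∣mix∣≤mix∣∣ _ _)
    (mix-mono-≤ (∣μRestr∣≤μRestr∣∣ J y _) (∣μRestr∣≤μRestr∣∣ J y _))

  ∣a₁-mix∣≤∣a₁-a₀∣ : ∀ a₁ a₀ → ℚ.∣ a₁ - (q * a₁ + (1ℚ - q) * a₀) ∣ ≤ ℚ.∣ a₁ - a₀ ∣
  ∣a₁-mix∣≤∣a₁-a₀∣ a₁ a₀ = begin
    ℚ.∣ a₁ - (q * a₁ + (1ℚ - q) * a₀) ∣   ≡⟨ cong ℚ.∣_∣ (identity q a₁ a₀) ⟩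
    ℚ.∣ (1ℚ - q) * (a₁ - a₀) ∣            ≤⟨ ∣t*p∣≤∣p∣ (a₁ - a₀) (p≤q⇒0≤q-p q≤1) 1-q≤1 ⟩
    ℚ.∣ a₁ - a₀ ∣                         ∎
    where
    identity : ∀ q a₁ a₀ → a₁ - (q * a₁ + (1ℚ - q) * a₀) ≡ (1ℚ - q) * (a₁ - a₀)
    identity = solve-∀ ℚ-ring
    1-q≤1 : 1ℚ - q ≤ 1ℚ
    1-q≤1 = subst (1ℚ - q ≤_) (ℚₚ.+-identityʳ 1ℚ) (ℚₚ.+-monoʳ-≤ 1ℚ (ℚₚ.neg-antimono-≤ 0≤q))

  ∣a₀-mix∣≤∣a₁-a₀∣ : ∀ a₁ a₀ → ℚ.∣ a₀ - (q * a₁ + (1ℚ - q) * a₀) ∣ ≤ ℚ.∣ a₁ - a₀ ∣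
  ∣a₀-mix∣≤∣a₁-a₀∣ a₁ a₀ = begin
    ℚ.∣ a₀ - (q * a₁ + (1ℚ - q) * a₀) ∣   ≡⟨ cong ℚ.∣_∣ (identity q a₁ a₀) ⟩
    ℚ.∣ - (q * (a₁ - a₀)) ∣               ≡⟨ ℚₚ.∣-p∣≡∣p∣ (q * (a₁ - a₀)) ⟩
    ℚ.∣ q * (a₁ - a₀) ∣                   ≤⟨ ∣t*p∣≤∣p∣ (a₁ - a₀) 0≤q q≤1 ⟩
    ℚ.∣ a₁ - a₀ ∣                         ∎
    where
    identity : ∀ q a₁ a₀ → a₀ - (q * a₁ + (1ℚ - q) * a₀) ≡ - (q * (a₁ - a₀))
    identity = solve-∀ ℚ-ring

  μ≤μRestr-⊥ : ∀ {n} (J : Subset n) {W} → Antitone W → μ {n} q (W ∘ ∣_∣) ≤ μRestr q J ⊥ (W ∘ ∣_∣)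
  μ≤μRestr-⊥ [] W↓ = ℚₚ.≤-refl
  μ≤μRestr-⊥ {suc n} (true ∷ J) {W} W↓ = begin
    q * μₙ (W ∘ suc ∘ ∣_∣) + (1ℚ - q) * μₙ (W ∘ ∣_∣)   ≤⟨ mix-mono-≤ (μRestr-mono {n} ⊥ ⊥ (W↓ ∘ ∣_∣)) ℚₚ.≤-refl ⟩
    q * μₙ (W ∘ ∣_∣) + (1ℚ - q) * μₙ (W ∘ ∣_∣)         ≡⟨ mix-idem q (μₙ (W ∘ ∣_∣)) ⟩
    μₙ (W ∘ ∣_∣)                                       ≤⟨ μ≤μRestr-⊥ J W↓ ⟩
    μRestr q J ⊥ (W ∘ ∣_∣)                             ∎
    where
    μₙ = μ {n} q
    mix-idem : ∀ q a → q * a + (1ℚ - q) * a ≡ a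
    mix-idem = solve-∀ ℚ-ring
  μ≤μRestr-⊥ (false ∷ J) W↓ = mix-mono-≤ (μ≤μRestr-⊥ J (W↓ ∘ suc)) (μ≤μRestr-⊥ J W↓)

  mean-influence≤μRestr-⊥ : ∀ {n} (J : Subset n) {W} (f : Subset (suc n) → ℚ) → Antitone W → InfluenceBound W f →
                            ℚ.∣ μ q (f ∘ (true ∷_)) - μ q (f ∘ (false ∷_)) ∣ ≤ μRestr q J ⊥ (W ∘ ∣_∣)
  mean-influence≤μRestr-⊥ {n} J {W} f W↓ f≤W = begin
    ℚ.∣ μ q (f ∘ (true ∷_)) - μ q (f ∘ (false ∷_)) ∣          ≡⟨ cong ℚ.∣_∣ (μRestr-- {n = n} ⊥ ⊥ _ _) ⟨
    ℚ.∣ μ q (λ x → f (true ∷ x) - f (false ∷ x)) ∣            ≤⟨ ∣μRestr∣≤μRestr∣∣ {n} ⊥ ⊥ _ ⟩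
    μ q (λ x → ℚ.∣ f (true ∷ x) - f (false ∷ x) ∣)            ≤⟨ μRestr-mono {n} ⊥ ⊥ (λ x → f≤W (false ∷ x) zero) ⟩
    μ {n} q (W ∘ ∣_∣)                                          ≤⟨ μ≤μRestr-⊥ J W↓ ⟩
    μRestr q J ⊥ (W ∘ ∣_∣)                                     ∎

  -- The weight is averaged with the fixed coordinates set to 0; as W is antitone,
  -- this dominates the average under any other setting of them.
  μRestr-deviation : ∀ {n} (J y : Subset n) {W} (f : Subset n → ℚ) → Antitone W → InfluenceBound W f →
                     ℚ.∣ μRestr q J y f - μ q f ∣ ≤ toℚ ∣ J ∣ * μRestr q J ⊥ (W ∘ ∣_∣)
  μRestr-deviation [] [] {W} f _ _ = begin
    ℚ.∣ f [] - f [] ∣     ≡⟨ cong ℚ.∣_∣ (ℚₚ.+-inverseʳ (f [])) ⟩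
    0ℚ                    ≡⟨ ℚₚ.*-zeroˡ (W 0) ⟨
    0ℚ * W 0              ∎
  μRestr-deviation (false ∷ J) (_ ∷ y) {W} f W↓ f≤W = begin
    ℚ.∣ (q * a₁ + (1ℚ - q) * a₀) - (q * m₁ + (1ℚ - q) * m₀) ∣
      ≡⟨ cong ℚ.∣_∣ (mix-distrib-sub q a₁ m₁ a₀ m₀) ⟨
    ℚ.∣ q * (a₁ - m₁) + (1ℚ - q) * (a₀ - m₀) ∣
      ≤⟨ ∣mix∣≤mix∣∣ (a₁ - m₁) (a₀ - m₀) ⟩
    q * ℚ.∣ a₁ - m₁ ∣ + (1ℚ - q) * ℚ.∣ a₀ - m₀ ∣
      ≤⟨ mix-mono-≤ (μRestr-deviation J y _ (W↓ ∘ suc) (λ x i → f≤W (true ∷ x) (suc i)))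
                    (μRestr-deviation J y _ W↓ (λ x i → f≤W (false ∷ x) (suc i))) ⟩
    q * (j * D₁) + (1ℚ - q) * (j * D₀)
      ≡⟨ mix-distrib-*ˡ q j D₁ D₀ ⟩
    j * (q * D₁ + (1ℚ - q) * D₀)
      ∎
    where
    a₁ = μRestr q J y (λ x → f (true ∷ x))
    a₀ = μRestr q J y (λ x → f (false ∷ x))
    m₁ = μ q (λ x → f (true ∷ x))
    m₀ = μ q (λ x → f (false ∷ x))
    j = toℚ ∣ J ∣
    D₁ = μRestr q J ⊥ (W ∘ suc ∘ ∣_∣)
    D₀ = μRestr q J ⊥ (W ∘ ∣_∣)
  μRestr-deviation {suc n} (true ∷ J) (b ∷ y) {W} f W↓ f≤W = begin
    ℚ.∣ a - m ∣                          ≤⟨ ∣p-r∣≤∣p-q∣+∣q-r∣ a (mᵇ b) m ⟩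
    ℚ.∣ a - mᵇ b ∣ + ℚ.∣ mᵇ b - m ∣     ≤⟨ ℚₚ.+-mono-≤ (restricted b) (ℚₚ.≤-trans (endpoint b) (mean-influence≤μRestr-⊥ J f W↓ f≤W)) ⟩
    j * D + D                            ≡⟨ j*D+D≡[1+j]*D j D ⟩
    (1ℚ + j) * D                         ∎
    where
    a = μRestr q J y (λ x → f (b ∷ x))
    mᵇ : Bool → ℚ
    mᵇ b = μ {n} q (λ x → f (b ∷ x))
    m = q * mᵇ true + (1ℚ - q) * mᵇ false
    j = toℚ ∣ J ∣
    D = μRestr q J ⊥ (W ∘ ∣_∣)
    restricted : ∀ b → ℚ.∣ μRestr q J y (λ x → f (b ∷ x)) - mᵇ b ∣ ≤ j * D
    restricted true = ℚₚ.≤-trans (μRestr-deviation J y _ (W↓ ∘ suc) (λ x i → f≤W (true ∷ x) (suc i)))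
                                  (*-monoˡ-≤-≥0 (0≤toℚ ∣ J ∣) (μRestr-mono J ⊥ (W↓ ∘ ∣_∣)))
    restricted false = μRestr-deviation J y _ W↓ (λ x i → f≤W (false ∷ x) (suc i))
    endpoint : ∀ b → ℚ.∣ mᵇ b - m ∣ ≤ ℚ.∣ mᵇ true - mᵇ false ∣
    endpoint true = ∣a₁-mix∣≤∣a₁-a₀∣ (mᵇ true) (mᵇ false)
    endpoint false = ∣a₀-mix∣≤∣a₁-a₀∣ (mᵇ true) (mᵇ false)
    j*D+D≡[1+j]*D : ∀ j D → j * D + D ≡ (1ℚ + j) * D
    j*D+D≡[1+j]*D = solve-∀ ℚ-ring

  -- q/(s+1) + (1-q)/s ≤ 1/(s + q/2): halving the drift q leaves the slack
  -- ½q(s - 1 + q) ≥ 0 for every s ≥ 1.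
  mix-reciprocals : ∀ {D₁ D₀ s} → 1ℚ ≤ s → D₁ * (s + 1ℚ) ≤ 1ℚ → D₀ * s ≤ 1ℚ →
                    (q * D₁ + (1ℚ - q) * D₀) * (s + q * ½) ≤ 1ℚ
  mix-reciprocals {D₁} {D₀} {s} 1≤s D₁≤ D₀≤ = ℚₚ.*-cancelʳ-≤-pos K {{ℚ.positive 0<K}} (begin
    (q * D₁ + (1ℚ - q) * D₀) * (s + q * ½) * K
      ≡⟨ expand q D₁ D₀ s ⟩
    c₁ * (D₁ * (s + 1ℚ)) + c₀ * (D₀ * s)
      ≤⟨ ℚₚ.+-mono-≤ (*-monoˡ-≤-≥0 0≤c₁ D₁≤) (*-monoˡ-≤-≥0 0≤c₀ D₀≤) ⟩
    c₁ * 1ℚ + c₀ * 1ℚ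
      ≡⟨ collect q s ⟩
    K - ½ * q * (s - 1ℚ + q)
      ≤⟨ ℚₚ.+-monoʳ-≤ K (ℚₚ.neg-antimono-≤ (0≤* (0≤* 0≤½ 0≤q) 0≤s-1+q)) ⟩
    K - 0ℚ
      ≡⟨ K-0≡1*K K ⟩
    1ℚ * K ∎)
    where
    K = s * (s + 1ℚ)
    c₁ = q * (s + q * ½) * s
    c₀ = (1ℚ - q) * (s + q * ½) * (s + 1ℚ)
    0≤s : 0ℚ ≤ s
    0≤s = ℚₚ.≤-trans 0≤1 1≤s
    0≤s-1+q : 0ℚ ≤ s - 1ℚ + q
    0≤s-1+q = 0≤+ (p≤q⇒0≤q-p 1≤s) 0≤q
    0<K : 0ℚ < K
    0<K = ℚₚ.<-≤-trans (ℚₚ.positive⁻¹ 1ℚ) (begin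
      1ℚ              ≡⟨ ℚₚ.*-identityˡ 1ℚ ⟨
      1ℚ * 1ℚ         ≤⟨ ℚₚ.≤-trans (*-monoʳ-≤-≥0 0≤1 1≤s) (*-monoˡ-≤-≥0 0≤s 1≤s+1) ⟩
      s * (s + 1ℚ)    ∎)
      where
      1≤s+1 : 1ℚ ≤ s + 1ℚ
      1≤s+1 = subst (_≤ s + 1ℚ) (ℚₚ.+-identityˡ 1ℚ) (ℚₚ.+-monoˡ-≤ 1ℚ 0≤s)
    0≤c₁ : 0ℚ ≤ c₁
    0≤c₁ = 0≤* (0≤* 0≤q (0≤+ 0≤s (0≤* 0≤q 0≤½))) 0≤s
    0≤c₀ : 0ℚ ≤ c₀
    0≤c₀ = 0≤* (0≤* (p≤q⇒0≤q-p q≤1) (0≤+ 0≤s (0≤* 0≤q 0≤½))) (0≤+ 0≤s 0≤1)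
    expand : ∀ q D₁ D₀ s → (q * D₁ + (1ℚ - q) * D₀) * (s + q * ½) * (s * (s + 1ℚ))
           ≡ q * (s + q * ½) * s * (D₁ * (s + 1ℚ)) + (1ℚ - q) * (s + q * ½) * (s + 1ℚ) * (D₀ * s)
    expand = solve-∀ ℚ-ring
    collect : ∀ q s → q * (s + q * ½) * s * 1ℚ + (1ℚ - q) * (s + q * ½) * (s + 1ℚ) * 1ℚ
            ≡ s * (s + 1ℚ) - ½ * q * (s - 1ℚ + q)
    collect = solve-∀ ℚ-ring
    K-0≡1*K : ∀ K → K - 0ℚ ≡ 1ℚ * K
    K-0≡1*K = solve-∀ ℚ-ring

  μRestr-harmonic : ∀ {n} (J : Subset n) a →
    μRestr q J ⊥ (λ x → 1/[1+ ∣ x ∣ ℕ.+ a ]) * (q * ½ * toℚ ∣ ∁ J ∣ + toℚ (suc a)) ≤ 1ℚ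
  μRestr-harmonic [] a = ℚₚ.≤-reflexive (trans (rearrange (q * ½) 1/[1+ a ] (toℚ (suc a))) (toℚ-suc*1/[1+]≡1 a))
    where
    rearrange : ∀ c d t → d * (c * 0ℚ + t) ≡ t * d
    rearrange = solve-∀ ℚ-ring
  μRestr-harmonic (true ∷ J) a = μRestr-harmonic J a
  μRestr-harmonic (false ∷ J) a = begin
    (q * D₁′ + (1ℚ - q) * D₀) * (α * (1ℚ + N) + (1ℚ + A))   ≡⟨ cong₂ (λ d t → (q * d + (1ℚ - q) * D₀) * t) D₁′≡D₁ (shift α N A) ⟩
    (q * D₁ + (1ℚ - q) * D₀) * (s + α)                       ≤⟨ mix-reciprocals 1≤s D₁*[s+1]≤1 (μRestr-harmonic J a) ⟩
    1ℚ                                                       ∎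
    where
    α = q * ½
    N = toℚ ∣ ∁ J ∣
    A = toℚ a
    s = α * N + (1ℚ + A)
    D₁′ = μRestr q J ⊥ (λ x → 1/[1+ suc ∣ x ∣ ℕ.+ a ])
    D₁ = μRestr q J ⊥ (λ x → 1/[1+ ∣ x ∣ ℕ.+ suc a ])
    D₀ = μRestr q J ⊥ (λ x → 1/[1+ ∣ x ∣ ℕ.+ a ])
    shift : ∀ α N A → α * (1ℚ + N) + (1ℚ + A) ≡ α * N + (1ℚ + A) + α
    shift = solve-∀ ℚ-ring
    reassoc : ∀ α N A → α * N + (1ℚ + (1ℚ + A)) ≡ α * N + (1ℚ + A) + 1ℚ
    reassoc = solve-∀ ℚ-ring
    D₁′≡D₁ : D₁′ ≡ D₁
    D₁′≡D₁ = μRestr-cong J ⊥ (λ x → cong 1/[1+_] (sym (ℕₚ.+-suc ∣ x ∣ a)))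
    1≤s : 1ℚ ≤ s
    1≤s = subst (_≤ s) (ℚₚ.+-identityˡ 1ℚ) (ℚₚ.+-mono-≤ (0≤* (0≤* 0≤q 0≤½) (0≤toℚ ∣ ∁ J ∣)) (1≤toℚ-suc a))
    D₁*[s+1]≤1 : D₁ * (s + 1ℚ) ≤ 1ℚ
    D₁*[s+1]≤1 = subst (λ t → D₁ * t ≤ 1ℚ) (reassoc α N A) (μRestr-harmonic J (suc a))

card : ∀ {n} → (Subset n → Bool) → ℕ
card {zero} p = if p [] then 1 else 0
card {suc n} p = card (p ∘ (true ∷_)) ℕ.+ card (p ∘ (false ∷_))

card-cong : ∀ {n} {p r : Subset n → Bool} → (∀ A → p A ≡ r A) → card p ≡ card r
card-cong {zero} p≗r rewrite p≗r [] = refl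
card-cong {suc n} p≗r = cong₂ ℕ._+_ (card-cong (p≗r ∘ (true ∷_))) (card-cong (p≗r ∘ (false ∷_)))

card-const-false : ∀ {n} → card {n} (λ _ → false) ≡ 0
card-const-false {zero} = refl
card-const-false {suc n} = cong₂ ℕ._+_ (card-const-false {n}) (card-const-false {n})

length-filter-map : ∀ {A B : Set} {P : Pred B 0ℓ} (P? : Decidable P) (g : A → B) xs →
                    length (filter P? (map g xs)) ≡ length (filter (P? ∘ g) xs)
length-filter-map P? g [] = refl
length-filter-map P? g (x ∷ xs) with does (P? (g x))
... | true = cong suc (length-filter-map P? g xs)
... | false = length-filter-map P? g xs

length-filter-allSubsets : ∀ {n} {P : Pred (Subset n) 0ℓ} (P? : Decidable P) →
                           length (filter P? (allSubsets n)) ≡ card (does ∘ P?)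
length-filter-allSubsets {zero} P? with does (P? [])
... | true = refl
... | false = refl
length-filter-allSubsets {suc n} P? = begin-equality
  length (filter P? (map (true ∷_) S ++ map (false ∷_) S))
    ≡⟨ cong length (filter-++ P? (map (true ∷_) S) (map (false ∷_) S)) ⟩
  length (filter P? (map (true ∷_) S) ++ filter P? (map (false ∷_) S))
    ≡⟨ length-++ (filter P? (map (true ∷_) S)) ⟩
  length (filter P? (map (true ∷_) S)) ℕ.+ length (filter P? (map (false ∷_) S))
    ≡⟨ cong₂ ℕ._+_ (trans (length-filter-map P? (true ∷_) S) (length-filter-allSubsets (P? ∘ (true ∷_))))
                   (trans (length-filter-map P? (false ∷_) S) (length-filter-allSubsets (P? ∘ (false ∷_)))) ⟩
  card (does ∘ P?) ∎
  where
  open ℕₚ.≤-Reasoning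
  S = allSubsets n

counted : ∀ {n} (k : ℕ) (F : Subset n → Bool) (x : Subset n) → Subset n → Bool
counted k F x A = does ((A ⊆? x) ×-dec ((∣ A ∣ ℕ.≟ k) ×-dec T? (F A)))

count : ∀ {n} (k : ℕ) (F : Subset n → Bool) (x : Subset n) → ℕ
count k F x = card (counted k F x)

countIn≡count : ∀ {n} k F (x : Subset n) → countIn k F x ≡ count k F x
countIn≡count k F x = length-filter-allSubsets (λ A → (A ⊆? x) ×-dec ((∣ A ∣ ℕ.≟ k) ×-dec T? (F A)))

count-zero-true : ∀ {n} F (x : Subset n) → count 0 F (true ∷ x) ≡ count 0 (F ∘ (false ∷_)) x
count-zero-true {n} F x = cong (ℕ._+ count 0 (F ∘ (false ∷_)) x)
  (trans (card-cong (λ A → ∧-zeroʳ (does (A ⊆? x)))) (card-const-false {n}))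

count-false : ∀ {n} k F (x : Subset n) → count k F (false ∷ x) ≡ count k (F ∘ (false ∷_)) x
count-false {n} k F x = cong (ℕ._+ count k (F ∘ (false ∷_)) x) (card-const-false {n})

binom : ℕ → ℕ → ℕ
binom _ zero = 1
binom zero (suc k) = 0
binom (suc m) (suc k) = binom m k ℕ.+ binom m (suc k)

-- binomThrough m k = C(m, k - 1), the number of k-subsets of an (m+1)-set
-- containing a fixed point (0 when k = 0).
binomThrough : ℕ → ℕ → ℕ
binomThrough m zero = 0
binomThrough m (suc k) = binom m k

binom≡C : ∀ m k → binom m k ≡ m C k
binom≡C m zero = refl
binom≡C zero (suc k) = refl
binom≡C (suc m) (suc k) = trans (cong₂ ℕ._+_ (binom≡C m k) (binom≡C m (suc k))) (nCk+nC[k+1]≡[n+1]C[k+1] m k)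

binom-pos : ∀ {m k} → k ℕ.≤ m → 1 ℕ.≤ binom m k
binom-pos {m} {zero} _ = ℕ.s≤s ℕ.z≤n
binom-pos {suc m} {suc k} (ℕ.s≤s k≤m) = ℕₚ.≤-trans (binom-pos k≤m) (ℕₚ.m≤m+n (binom m k) _)

binom-suc : ∀ m k → binom (suc m) k ≡ binom m k ℕ.+ binomThrough m k
binom-suc m zero = refl
binom-suc m (suc k) = ℕₚ.+-comm (binom m k) (binom m (suc k))

binomThrough-suc : ∀ m k → binomThrough (suc m) (suc k) ≡ binomThrough m k ℕ.+ binomThrough m (suc k)
binomThrough-suc m zero = refl
binomThrough-suc m (suc k) = refl

binom-absorption : ∀ m j → suc j ℕ.* binom (suc m) (suc j) ≡ suc m ℕ.* binom m j
binom-absorption zero zero = refl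
binom-absorption zero (suc j) = ℕₚ.*-zeroʳ (suc (suc j))
binom-absorption (suc m) zero = cong suc (binom-absorption m zero)
binom-absorption (suc m) (suc j) = begin-equality
  (2 ℕ.+ j) ℕ.* (b₁ ℕ.+ b₂)                                            ≡⟨ split j b₁ b₂ ⟩
  b₁ ℕ.+ (1 ℕ.+ j) ℕ.* b₁ ℕ.+ (2 ℕ.+ j) ℕ.* b₂                         ≡⟨ cong₂ (λ u v → b₁ ℕ.+ u ℕ.+ v) (binom-absorption m j) (binom-absorption m (suc j)) ⟩
  (c₀ ℕ.+ c₁) ℕ.+ (1 ℕ.+ m) ℕ.* c₀ ℕ.+ (1 ℕ.+ m) ℕ.* c₁               ≡⟨ merge m c₀ c₁ ⟩
  (2 ℕ.+ m) ℕ.* (c₀ ℕ.+ c₁)                                            ∎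
  where
  open ℕₚ.≤-Reasoning
  b₁ = binom (suc m) (suc j)
  b₂ = binom (suc m) (suc (suc j))
  c₀ = binom m j
  c₁ = binom m (suc j)
  split : ∀ j a b → (2 ℕ.+ j) ℕ.* (a ℕ.+ b) ≡ a ℕ.+ (1 ℕ.+ j) ℕ.* a ℕ.+ (2 ℕ.+ j) ℕ.* b
  split = ℕ-solve-∀
  merge : ∀ m x y → (x ℕ.+ y) ℕ.+ (1 ℕ.+ m) ℕ.* x ℕ.+ (1 ℕ.+ m) ℕ.* y ≡ (2 ℕ.+ m) ℕ.* (x ℕ.+ y)
  merge = ℕ-solve-∀

k*binom[1+m,k]≡[1+m]*binomThrough[m,k] : ∀ m k → k ℕ.* binom (suc m) k ≡ suc m ℕ.* binomThrough m k
k*binom[1+m,k]≡[1+m]*binomThrough[m,k] m zero = sym (ℕₚ.*-zeroʳ (suc m))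
k*binom[1+m,k]≡[1+m]*binomThrough[m,k] m (suc j) = binom-absorption m j

count≤binom : ∀ {n} k F (x : Subset n) → count k F x ℕ.≤ binom ∣ x ∣ k
count≤binom {zero} zero F [] with does (T? (F []))
... | true = ℕₚ.≤-refl
... | false = ℕ.z≤n
count≤binom {zero} (suc k) F [] = ℕ.z≤n
count≤binom {suc n} zero F (true ∷ x) rewrite count-zero-true F x = count≤binom zero _ x
count≤binom {suc n} (suc k) F (true ∷ x) = ℕₚ.+-mono-≤ (count≤binom k _ x) (count≤binom (suc k) _ x)
count≤binom {suc n} k F (false ∷ x) rewrite count-false k F x = count≤binom k _ x

∣x[i]≔true∣≡1+∣x[i]≔false∣ : ∀ {n} (x : Subset n) i → ∣ x [ i ]≔ true ∣ ≡ suc ∣ x [ i ]≔ false ∣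
∣x[i]≔true∣≡1+∣x[i]≔false∣ (b ∷ x) zero = refl
∣x[i]≔true∣≡1+∣x[i]≔false∣ (true ∷ x) (suc i) = cong suc (∣x[i]≔true∣≡1+∣x[i]≔false∣ x i)
∣x[i]≔true∣≡1+∣x[i]≔false∣ (false ∷ x) (suc i) = ∣x[i]≔true∣≡1+∣x[i]≔false∣ x i

count-mono : ∀ {n} k F (x : Subset n) i → count k F (x [ i ]≔ false) ℕ.≤ count k F (x [ i ]≔ true)
count-mono zero F (b ∷ x) zero rewrite count-zero-true F x | count-false zero F x = ℕₚ.≤-refl
count-mono (suc k) F (b ∷ x) zero rewrite count-false (suc k) F x = ℕₚ.m≤n+m _ _
count-mono k F (false ∷ x) (suc i)
  rewrite count-false k F (x [ i ]≔ false) | count-false k F (x [ i ]≔ true) = count-mono k _ x i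
count-mono zero F (true ∷ x) (suc i)
  rewrite count-zero-true F (x [ i ]≔ false) | count-zero-true F (x [ i ]≔ true) = count-mono zero _ x i
count-mono (suc k) F (true ∷ x) (suc i) = ℕₚ.+-mono-≤ (count-mono k _ x i) (count-mono (suc k) _ x i)

-- Adding a point to x creates only the k-subsets through that point.
count-step : ∀ {n} k F (x : Subset n) i →
             count k F (x [ i ]≔ true) ℕ.≤ count k F (x [ i ]≔ false) ℕ.+ binomThrough ∣ x [ i ]≔ false ∣ k
count-step zero F (b ∷ x) zero rewrite count-zero-true F x | count-false zero F x = ℕₚ.m≤m+n _ _
count-step (suc k) F (b ∷ x) zero rewrite count-false (suc k) F x =
  ℕₚ.≤-trans (ℕₚ.+-monoˡ-≤ _ (count≤binom k _ x)) (ℕₚ.≤-reflexive (ℕₚ.+-comm (binom ∣ x ∣ k) _))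
count-step k F (false ∷ x) (suc i)
  rewrite count-false k F (x [ i ]≔ false) | count-false k F (x [ i ]≔ true) = count-step k _ x i
count-step zero F (true ∷ x) (suc i)
  rewrite count-zero-true F (x [ i ]≔ false) | count-zero-true F (x [ i ]≔ true) = count-step zero _ x i
count-step (suc k) F (true ∷ x) (suc i) rewrite binomThrough-suc ∣ x [ i ]≔ false ∣ k =
  ℕₚ.≤-trans (ℕₚ.+-mono-≤ (count-step k _ x i) (count-step (suc k) _ x i))
             (ℕₚ.≤-reflexive (interchange (count k _ x₀) (binomThrough ∣ x₀ ∣ k) (count (suc k) _ x₀) (binomThrough ∣ x₀ ∣ (suc k))))
  where
  x₀ = x [ i ]≔ false
  interchange : ∀ a b c d → (a ℕ.+ b) ℕ.+ (c ℕ.+ d) ≡ (a ℕ.+ c) ℕ.+ (b ℕ.+ d)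
  interchange = ℕ-solve-∀

cross-multiplied-gap : ∀ a b {c₀ c₁} → c₀ ℕ.≤ c₁ → c₁ ℕ.≤ c₀ ℕ.+ b → c₀ ℕ.≤ suc a →
  c₁ ℕ.* suc a ℕ.≤ c₀ ℕ.* suc (a ℕ.+ b) ℕ.+ b ℕ.* suc a ×
  c₀ ℕ.* suc (a ℕ.+ b) ℕ.≤ c₁ ℕ.* suc a ℕ.+ b ℕ.* suc a
cross-multiplied-gap a b {c₀} {c₁} c₀≤c₁ c₁≤c₀+b c₀≤A = upper , lower
  where
  open ℕₚ.≤-Reasoning
  A = suc a
  upper : c₁ ℕ.* A ℕ.≤ c₀ ℕ.* (A ℕ.+ b) ℕ.+ b ℕ.* A
  upper = begin
    c₁ ℕ.* A                 ≤⟨ ℕₚ.*-monoˡ-≤ A c₁≤c₀+b ⟩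
    (c₀ ℕ.+ b) ℕ.* A         ≡⟨ ℕₚ.*-distribʳ-+ A c₀ b ⟩
    c₀ ℕ.* A ℕ.+ b ℕ.* A     ≤⟨ ℕₚ.+-monoˡ-≤ (b ℕ.* A) (ℕₚ.*-monoʳ-≤ c₀ (ℕₚ.m≤m+n A b)) ⟩
    c₀ ℕ.* (A ℕ.+ b) ℕ.+ b ℕ.* A     ∎
  lower : c₀ ℕ.* (A ℕ.+ b) ℕ.≤ c₁ ℕ.* A ℕ.+ b ℕ.* A
  lower = begin
    c₀ ℕ.* (A ℕ.+ b)         ≡⟨ ℕₚ.*-distribˡ-+ c₀ A b ⟩
    c₀ ℕ.* A ℕ.+ c₀ ℕ.* b    ≤⟨ ℕₚ.+-mono-≤ (ℕₚ.*-monoˡ-≤ A c₀≤c₁) (ℕₚ.*-monoˡ-≤ b c₀≤A) ⟩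
    c₁ ℕ.* A ℕ.+ A ℕ.* b     ≡⟨ cong (c₁ ℕ.* A ℕ.+_) (ℕₚ.*-comm A b) ⟩
    c₁ ℕ.* A ℕ.+ b ℕ.* A     ∎

toℚ-mono-≤-*+* : ∀ {u v w x y z} → u ℕ.* v ℕ.≤ w ℕ.* x ℕ.+ y ℕ.* z →
                 toℚ u * toℚ v ≤ toℚ w * toℚ x + toℚ y * toℚ z
toℚ-mono-≤-*+* {u} {v} {w} {x} {y} {z} h = subst₂ _≤_ (toℚ-* u v)
  (trans (toℚ-+ (w ℕ.* x) (y ℕ.* z)) (cong₂ _+_ (toℚ-* w x) (toℚ-* y z))) (toℚ-mono-≤ h)

common-denominator : ∀ c₁ c₀ a s →
  (toℚ c₁ * toℚ (suc a) - toℚ c₀ * toℚ (suc s)) * (1/[1+ a ] * 1/[1+ s ]) ≡ toℚ c₁ * 1/[1+ s ] - toℚ c₀ * 1/[1+ a ]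
common-denominator c₁ c₀ a s = begin-equality
  (toℚ c₁ * A - toℚ c₀ * S) * (iA * iS)             ≡⟨ regroup (toℚ c₁) (toℚ c₀) A S iA iS ⟩
  toℚ c₁ * iS * (A * iA) - toℚ c₀ * iA * (S * iS)   ≡⟨ cong₂ (λ u v → toℚ c₁ * iS * u - toℚ c₀ * iA * v)
                                                         (toℚ-suc*1/[1+]≡1 a) (toℚ-suc*1/[1+]≡1 s) ⟩
  toℚ c₁ * iS * 1ℚ - toℚ c₀ * iA * 1ℚ               ≡⟨ cong₂ _-_ (ℚₚ.*-identityʳ (toℚ c₁ * iS)) (ℚₚ.*-identityʳ (toℚ c₀ * iA)) ⟩
  toℚ c₁ * iS - toℚ c₀ * iA                         ∎
  where
  open ℚₚ.≤-Reasoning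
  A = toℚ (suc a)
  S = toℚ (suc s)
  iA = 1/[1+ a ]
  iS = 1/[1+ s ]
  regroup : ∀ c₁ c₀ A S iA iS → (c₁ * A - c₀ * S) * (iA * iS) ≡ c₁ * iS * (A * iA) - c₀ * iA * (S * iS)
  regroup = solve-∀ ℚ-ring

1/[1+]-cancelˡ : ∀ b a s → toℚ b * toℚ (suc a) * (1/[1+ a ] * 1/[1+ s ]) ≡ toℚ b * 1/[1+ s ]
1/[1+]-cancelˡ b a s = begin-equality
  toℚ b * toℚ (suc a) * (1/[1+ a ] * 1/[1+ s ])   ≡⟨ regroup (toℚ b) (toℚ (suc a)) 1/[1+ a ] 1/[1+ s ] ⟩
  toℚ b * 1/[1+ s ] * (toℚ (suc a) * 1/[1+ a ])   ≡⟨ cong (toℚ b * 1/[1+ s ] *_) (toℚ-suc*1/[1+]≡1 a) ⟩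
  toℚ b * 1/[1+ s ] * 1ℚ                          ≡⟨ ℚₚ.*-identityʳ (toℚ b * 1/[1+ s ]) ⟩
  toℚ b * 1/[1+ s ]                               ∎
  where
  open ℚₚ.≤-Reasoning
  regroup : ∀ b A iA iS → b * A * (iA * iS) ≡ b * iS * (A * iA)
  regroup = solve-∀ ℚ-ring

-- Applied with a + 1 = C(m, k) and b = C(m, k - 1), so a + b + 1 = C(m + 1, k), to
-- the densities of 𝓕 among the k-subsets of x and of x ∪ {i}.
density-gap : ∀ a b {c₀ c₁} → c₀ ℕ.≤ c₁ → c₁ ℕ.≤ c₀ ℕ.+ b → c₀ ℕ.≤ suc a →
              ℚ.∣ toℚ c₁ * 1/[1+ a ℕ.+ b ] - toℚ c₀ * 1/[1+ a ] ∣ ≤ toℚ b * 1/[1+ a ℕ.+ b ]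
density-gap a b {c₀} {c₁} c₀≤c₁ c₁≤c₀+b c₀≤A = begin
  ℚ.∣ toℚ c₁ * iS - toℚ c₀ * iA ∣       ≡⟨ cong ℚ.∣_∣ (common-denominator c₁ c₀ a (a ℕ.+ b)) ⟨
  ℚ.∣ (P - Q) * (iA * iS) ∣             ≡⟨ ℚₚ.∣p*q∣≡∣p∣*∣q∣ (P - Q) (iA * iS) ⟩
  ℚ.∣ P - Q ∣ * ℚ.∣ iA * iS ∣           ≡⟨ cong (ℚ.∣ P - Q ∣ *_) (ℚₚ.0≤p⇒∣p∣≡p 0≤iA*iS) ⟩
  ℚ.∣ P - Q ∣ * (iA * iS)               ≤⟨ *-monoʳ-≤-≥0 0≤iA*iS (∣p-q∣≤r P≤Q+R Q≤P+R) ⟩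
  R * (iA * iS)                         ≡⟨ 1/[1+]-cancelˡ b a (a ℕ.+ b) ⟩
  toℚ b * iS                            ∎
  where
  open ℚₚ.≤-Reasoning
  A = toℚ (suc a)
  S = toℚ (suc (a ℕ.+ b))
  iA = 1/[1+ a ]
  iS = 1/[1+ a ℕ.+ b ]
  P = toℚ c₁ * A
  Q = toℚ c₀ * S
  R = toℚ b * A
  P≤Q+R : P ≤ Q + R
  P≤Q+R = toℚ-mono-≤-*+* {c₁} {suc a} {c₀} {suc (a ℕ.+ b)} {b} {suc a}
            (proj₁ (cross-multiplied-gap a b c₀≤c₁ c₁≤c₀+b c₀≤A))
  Q≤P+R : Q ≤ P + R
  Q≤P+R = toℚ-mono-≤-*+* {c₀} {suc (a ℕ.+ b)} {c₁} {suc a} {b} {suc a}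
            (proj₂ (cross-multiplied-gap a b c₀≤c₁ c₁≤c₀+b c₀≤A))
  0≤iA*iS : 0ℚ ≤ iA * iS
  0≤iA*iS = 0≤* (0≤1/[1+] a) (0≤1/[1+] (a ℕ.+ b))

toℚ*1/[1+]-cross : ∀ b s k m → b ℕ.* suc m ≡ k ℕ.* suc s → toℚ b * 1/[1+ s ] ≡ toℚ k * 1/[1+ m ]
toℚ*1/[1+]-cross b s k m cross = begin-equality
  toℚ b * 1/[1+ s ]                                       ≡⟨ ℚₚ.*-identityʳ _ ⟨
  toℚ b * 1/[1+ s ] * 1ℚ                                  ≡⟨ cong (toℚ b * 1/[1+ s ] *_) (toℚ-suc*1/[1+]≡1 m) ⟨
  toℚ b * 1/[1+ s ] * (toℚ (suc m) * 1/[1+ m ])           ≡⟨ regroup (toℚ b) 1/[1+ s ] (toℚ (suc m)) 1/[1+ m ] ⟩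
  toℚ b * toℚ (suc m) * 1/[1+ s ] * 1/[1+ m ]             ≡⟨ cong (λ t → t * 1/[1+ s ] * 1/[1+ m ]) cross′ ⟩
  toℚ k * toℚ (suc s) * 1/[1+ s ] * 1/[1+ m ]             ≡⟨ regroup′ (toℚ k) (toℚ (suc s)) 1/[1+ s ] 1/[1+ m ] ⟩
  toℚ k * 1/[1+ m ] * (toℚ (suc s) * 1/[1+ s ])           ≡⟨ cong (toℚ k * 1/[1+ m ] *_) (toℚ-suc*1/[1+]≡1 s) ⟩
  toℚ k * 1/[1+ m ] * 1ℚ                                  ≡⟨ ℚₚ.*-identityʳ _ ⟩
  toℚ k * 1/[1+ m ]                                       ∎
  where
  open ℚₚ.≤-Reasoning
  cross′ : toℚ b * toℚ (suc m) ≡ toℚ k * toℚ (suc s)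
  cross′ = trans (sym (toℚ-* b (suc m))) (trans (cong toℚ cross) (toℚ-* k (suc s)))
  regroup : ∀ b i t j → b * i * (t * j) ≡ b * t * i * j
  regroup = solve-∀ ℚ-ring
  regroup′ : ∀ k t i j → k * t * i * j ≡ k * j * (t * i)
  regroup′ = solve-∀ ℚ-ring

fF-below : ∀ {n} k F (x : Subset n) → ∣ x ∣ ℕ.< k → fF k F x ≡ 0ℚ
fF-below k F x ∣x∣<k with ∣ x ∣ ℕ.<? k
... | yes _ = refl
... | no ∣x∣≮k = contradiction ∣x∣<k ∣x∣≮k

fF-above : ∀ {n} k F (x : Subset n) {b} → k ℕ.≤ ∣ x ∣ → binom ∣ x ∣ k ≡ suc b →
           fF k F x ≡ toℚ (count k F x) * 1/[1+ b ]
fF-above k F x {b} k≤∣x∣ binom≡1+b with ∣ x ∣ ℕ.<? k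
... | yes ∣x∣<k = contradiction k≤∣x∣ (ℕₚ.<⇒≱ ∣x∣<k)
... | no _ with ∣ x ∣ C k | trans (sym (binom≡C ∣ x ∣ k)) binom≡1+b
...   | .(suc b) | refl = trans (cong (λ c → + c / suc b) (countIn≡count k F x)) (+a/[1+b]≡toℚa*1/[1+b] (count k F x) b)

binom-as-suc : ∀ {m k} → k ℕ.≤ m → Σ ℕ λ b → binom m k ≡ suc b
binom-as-suc {m} {k} k≤m with binom m k | binom-pos k≤m
... | suc b | _ = b , refl

∣fF∣≤1 : ∀ {n} k F (x : Subset n) → ℚ.∣ fF k F x ∣ ≤ 1ℚ
∣fF∣≤1 k F x with k ℕ.≤? ∣ x ∣
... | no k≰∣x∣ rewrite fF-below k F x (ℕₚ.≰⇒> k≰∣x∣) = 0≤1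
... | yes k≤∣x∣ = begin
  ℚ.∣ fF k F x ∣                       ≡⟨ cong ℚ.∣_∣ (fF-above k F x k≤∣x∣ binom≡1+b) ⟩
  ℚ.∣ toℚ c * 1/[1+ b ] ∣              ≡⟨ ℚₚ.0≤p⇒∣p∣≡p (0≤* (0≤toℚ c) (0≤1/[1+] b)) ⟩
  toℚ c * 1/[1+ b ]                    ≤⟨ *-monoʳ-≤-≥0 (0≤1/[1+] b) (toℚ-mono-≤ c≤1+b) ⟩
  toℚ (suc b) * 1/[1+ b ]              ≡⟨ toℚ-suc*1/[1+]≡1 b ⟩
  1ℚ                                   ∎
  where
  open ℚₚ.≤-Reasoning
  b = proj₁ (binom-as-suc k≤∣x∣)
  binom≡1+b = proj₂ (binom-as-suc k≤∣x∣)
  c = count k F x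
  c≤1+b : c ℕ.≤ suc b
  c≤1+b = subst (c ℕ.≤_) binom≡1+b (count≤binom k F x)

fF-influence : ∀ {n} k (F : Subset n → Bool) → InfluenceBound (λ m → toℚ k * 1/[1+ m ]) (fF k F)
fF-influence k F x i = by-size (ℕₚ.<-cmp (suc m) k)
  where
  open ℚₚ.≤-Reasoning
  x₀ = x [ i ]≔ false
  x₁ = x [ i ]≔ true
  m = ∣ x₀ ∣
  ∣x₁∣≡1+m : ∣ x₁ ∣ ≡ suc m
  ∣x₁∣≡1+m = ∣x[i]≔true∣≡1+∣x[i]≔false∣ x i
  by-size : Tri (suc m ℕ.< k) (suc m ≡ k) (k ℕ.< suc m) → ℚ.∣ fF k F x₁ - fF k F x₀ ∣ ≤ toℚ k * 1/[1+ m ]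
  by-size (tri< 1+m<k _ _)
    rewrite fF-below k F x₁ (subst (ℕ._< k) (sym ∣x₁∣≡1+m) 1+m<k)
          | fF-below k F x₀ (ℕₚ.<-trans (ℕₚ.n<1+n m) 1+m<k) = 0≤* (0≤toℚ k) (0≤1/[1+] m)
  by-size (tri≈ _ 1+m≡k _) rewrite fF-below k F x₀ (subst (m ℕ.<_) 1+m≡k (ℕₚ.n<1+n m)) = begin
    ℚ.∣ fF k F x₁ - 0ℚ ∣           ≡⟨ cong ℚ.∣_∣ (ℚₚ.+-identityʳ (fF k F x₁)) ⟩
    ℚ.∣ fF k F x₁ ∣                ≤⟨ ∣fF∣≤1 k F x₁ ⟩
    1ℚ                             ≡⟨ toℚ-suc*1/[1+]≡1 m ⟨
    toℚ (suc m) * 1/[1+ m ]        ≡⟨ cong (λ j → toℚ j * 1/[1+ m ]) 1+m≡k ⟩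
    toℚ k * 1/[1+ m ]              ∎
  by-size (tri> _ _ k<1+m) = begin
    ℚ.∣ fF k F x₁ - fF k F x₀ ∣                        ≡⟨ cong₂ (λ u v → ℚ.∣ u - v ∣) fF-x₁ fF-x₀ ⟩
    ℚ.∣ toℚ c₁ * 1/[1+ a ℕ.+ B ] - toℚ c₀ * 1/[1+ a ] ∣ ≤⟨ density-gap a B (count-mono k F x i) (count-step k F x i) c₀≤1+a ⟩
    toℚ B * 1/[1+ a ℕ.+ B ]                             ≡⟨ toℚ*1/[1+]-cross B (a ℕ.+ B) k m B*[1+m]≡k*[1+a+B] ⟩
    toℚ k * 1/[1+ m ]                                   ∎
    where
    k≤m = ℕₚ.≤-pred k<1+m
    a = proj₁ (binom-as-suc k≤m)
    binom≡1+a = proj₂ (binom-as-suc k≤m)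
    B = binomThrough m k
    c₀ = count k F x₀
    c₁ = count k F x₁
    binom[1+m]≡1+a+B : binom (suc m) k ≡ suc (a ℕ.+ B)
    binom[1+m]≡1+a+B = trans (binom-suc m k) (cong (ℕ._+ B) binom≡1+a)
    fF-x₀ : fF k F x₀ ≡ toℚ c₀ * 1/[1+ a ]
    fF-x₀ = fF-above k F x₀ k≤m binom≡1+a
    fF-x₁ : fF k F x₁ ≡ toℚ c₁ * 1/[1+ a ℕ.+ B ]
    fF-x₁ = fF-above k F x₁ (subst (k ℕ.≤_) (sym ∣x₁∣≡1+m) (ℕₚ.m≤n⇒m≤1+n k≤m))
              (trans (cong (λ s → binom s k) ∣x₁∣≡1+m) binom[1+m]≡1+a+B)
    c₀≤1+a : c₀ ℕ.≤ suc a
    c₀≤1+a = subst (c₀ ℕ.≤_) binom≡1+a (count≤binom k F x₀)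
    B*[1+m]≡k*[1+a+B] : B ℕ.* suc m ≡ k ℕ.* suc (a ℕ.+ B)
    B*[1+m]≡k*[1+a+B] = trans (ℕₚ.*-comm B (suc m)) (sym (trans (cong (k ℕ.*_) (sym binom[1+m]≡1+a+B))
                                                                  (k*binom[1+m,k]≡[1+m]*binomThrough[m,k] m k)))

[1+a]*j≤[1+d]+[1+a] : ∀ a d j → + j ℤ.≤ ℤ.- (ℤ.-[1+ d ] ℤ./ + suc a) → suc a ℕ.* j ℕ.≤ suc d ℕ.+ suc a
[1+a]*j≤[1+d]+[1+a] a d j j≤-F = begin
  suc a ℕ.* j           ≡⟨ ℕₚ.*-comm (suc a) j ⟩
  j ℕ.* suc a           ≤⟨ ℤₚ.drop‿+≤+ j*[1+a]≤r+[1+d] ⟩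
  r ℕ.+ suc d           ≤⟨ ℕₚ.+-monoˡ-≤ (suc d) (ℕₚ.<⇒≤ (n%d<d ℤ.-[1+ d ] N)) ⟩
  suc a ℕ.+ suc d       ≡⟨ ℕₚ.+-comm (suc a) (suc d) ⟩
  suc d ℕ.+ suc a       ∎
  where
  open ℕₚ.≤-Reasoning
  N = + suc a
  F = ℤ.-[1+ d ] ℤ./ N
  r = ℤ.-[1+ d ] ℤ.% N
  negate : ∀ fn r → ℤ.- fn ≡ r ℤ.- (r ℤ.+ fn)
  negate = ℤ-solve-∀
  -F*N≡r+[1+d] : ℤ.- (F ℤ.* N) ≡ + r ℤ.+ + suc d
  -F*N≡r+[1+d] = trans (negate (F ℤ.* N) (+ r)) (cong (λ X → + r ℤ.- X) (sym (a≡a%n+[a/n]*n ℤ.-[1+ d ] N)))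
  j*[1+a]≤r+[1+d] : + (j ℕ.* suc a) ℤ.≤ + (r ℕ.+ suc d)
  j*[1+a]≤r+[1+d] = subst₂ ℤ._≤_ (sym (ℤₚ.pos-* j (suc a))) (trans (sym (ℤₚ.neg-distribˡ-* F N)) -F*N≡r+[1+d])
                      (ℤₚ.*-monoʳ-≤-nonNeg N j≤-F)

-- ceiling p is - floor (- p), so for ε = (a+1)/(d+1) the bound comes from the
-- Euclidean division of -(d+1) by a+1 above.
ε*j≤1+ε : ∀ {ε} (0<ε : 0ℚ < ε) j → + j ℤ.≤ ceiling ((1/ ε) {{ℚ.>-nonZero 0<ε}}) → ε * toℚ j ≤ 1ℚ + ε
ε*j≤1+ε {ℚ.mkℚ ℤ.+[1+ a ] d coprime} _ j j≤⌈1/ε⌉ = begin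
  ε * toℚ j                                          ≡⟨ cong (_* toℚ j) ε≡[1+a]/[1+d] ⟩
  toℚ (suc a) * 1/[1+ d ] * toℚ j                    ≡⟨ swap (toℚ (suc a)) 1/[1+ d ] (toℚ j) ⟩
  toℚ (suc a) * toℚ j * 1/[1+ d ]                    ≡⟨ cong (_* 1/[1+ d ]) (toℚ-* (suc a) j) ⟨
  toℚ (suc a ℕ.* j) * 1/[1+ d ]                      ≤⟨ *-monoʳ-≤-≥0 (0≤1/[1+] d) (toℚ-mono-≤ ([1+a]*j≤[1+d]+[1+a] a d j j≤⌈1/ε⌉)) ⟩
  toℚ (suc d ℕ.+ suc a) * 1/[1+ d ]                  ≡⟨ cong (_* 1/[1+ d ]) (toℚ-+ (suc d) (suc a)) ⟩
  (toℚ (suc d) + toℚ (suc a)) * 1/[1+ d ]            ≡⟨ ℚₚ.*-distribʳ-+ 1/[1+ d ] (toℚ (suc d)) (toℚ (suc a)) ⟩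
  toℚ (suc d) * 1/[1+ d ] + toℚ (suc a) * 1/[1+ d ]  ≡⟨ cong₂ _+_ (toℚ-suc*1/[1+]≡1 d) (sym ε≡[1+a]/[1+d]) ⟩
  1ℚ + ε                                             ∎
  where
  open ℚₚ.≤-Reasoning
  ε = ℚ.mkℚ ℤ.+[1+ a ] d coprime
  swap : ∀ x y z → x * y * z ≡ x * z * y
  swap = solve-∀ ℚ-ring
  ε≡[1+a]/[1+d] : ε ≡ toℚ (suc a) * 1/[1+ d ]
  ε≡[1+a]/[1+d] = trans (sym (ℚₚ.↥p/↧p≡p ε)) (+a/[1+b]≡toℚa*1/[1+b] (suc a) d)
ε*j≤1+ε {ε@(ℚ.mkℚ (+ 0) _ _)} 0<ε = contradiction 0<ε (ℚₚ.<-irrefl (sym (ℚₚ.↥p≡0⇒p≡0 ε refl)))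
ε*j≤1+ε {ε@(ℚ.mkℚ ℤ.-[1+ _ ] _ _)} 0<ε = contradiction (ℚₚ.negative⁻¹ ε) (ℚₚ.<-asym 0<ε)

⅛ : ℚ
⅛ = + 1 / 8

j*k<ε*[q/2*N+1] : ∀ {ε q j k N} → 0ℚ < ε → ε ≤ q → 0ℚ ≤ k → 0ℚ ≤ N →
                  ε * j ≤ 1ℚ + 1ℚ → k < ε * ε * ε * ⅛ * (N + j) → j * k < ε * (q * ½ * N + 1ℚ)
j*k<ε*[q/2*N+1] {ε} {q} {j} {k} {N} 0<ε ε≤q 0≤k 0≤N εj≤2 k<δ[N+j] =
  ℚₚ.*-cancelˡ-<-nonNeg ε {{ℚ.nonNegative 0≤ε}} (begin-strict
    ε * (j * k)                          ≡⟨ ℚₚ.*-assoc ε j k ⟨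
    ε * j * k                            ≤⟨ *-monoʳ-≤-≥0 0≤k εj≤2 ⟩
    (1ℚ + 1ℚ) * k                        <⟨ ℚₚ.*-monoʳ-<-pos (1ℚ + 1ℚ) k<δ[N+j] ⟩
    (1ℚ + 1ℚ) * (ε * ε * ε * ⅛ * (N + j)) ≤⟨ diff-nonNeg ⟩
    ε * (ε * (q * ½ * N + 1ℚ))           ∎)
  where
  open ℚₚ.≤-Reasoning
  0≤ε = ℚₚ.<⇒≤ 0<ε
  ε² = ε * ε
  0≤ε² = 0≤* 0≤ε 0≤ε
  0≤¼ : 0ℚ ≤ + 1 / 4
  0≤¼ = ℚₚ.nonNegative⁻¹ (+ 1 / 4)
  gap : ∀ ε q N j → ε * (ε * (q * ½ * N + 1ℚ)) - (1ℚ + 1ℚ) * (ε * ε * ε * ⅛ * (N + j))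
      ≡ ε * ε * N * ((q - ε) * ½ + ε * (+ 1 / 4)) + ε * ε * (((1ℚ + 1ℚ) - ε * j) * (+ 1 / 4) + ½)
  gap = solve-∀ ℚ-ring
  diff-nonNeg : (1ℚ + 1ℚ) * (ε * ε * ε * ⅛ * (N + j)) ≤ ε * (ε * (q * ½ * N + 1ℚ))
  diff-nonNeg = 0≤q-p⇒p≤q (subst (0ℚ ≤_) (sym (gap ε q N j))
    (0≤+ (0≤* (0≤* 0≤ε² 0≤N) (0≤+ (0≤* (p≤q⇒0≤q-p ε≤q) 0≤½) (0≤* 0≤ε 0≤¼)))
         (0≤* 0≤ε² (0≤+ (0≤* (p≤q⇒0≤q-p εj≤2) 0≤¼) 0≤½))))

k/n<δ⇒k<δ*n : ∀ {δ} k n .{{_ : NonZero n}} → (+ k) / n < δ → toℚ k < δ * toℚ n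
k/n<δ⇒k<δ*n {δ} k (suc n) k/n<δ = begin-strict
  toℚ k                              ≡⟨ ℚₚ.*-identityʳ (toℚ k) ⟨
  toℚ k * 1ℚ                         ≡⟨ cong (toℚ k *_) (trans (sym (toℚ-suc*1/[1+]≡1 n)) (ℚₚ.*-comm (toℚ (suc n)) 1/[1+ n ])) ⟩
  toℚ k * (1/[1+ n ] * toℚ (suc n))  ≡⟨ ℚₚ.*-assoc (toℚ k) 1/[1+ n ] (toℚ (suc n)) ⟨
  toℚ k * 1/[1+ n ] * toℚ (suc n)    <⟨ ℚₚ.*-monoˡ-<-pos (toℚ (suc n)) {{ℚ.positive (toℚ-suc-pos n)}}
                                          (subst (_< δ) (+a/[1+b]≡toℚa*1/[1+b] k n) k/n<δ) ⟩
  δ * toℚ (suc n)                    ∎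
  where open ℚₚ.≤-Reasoning

n≡∣∁J∣+∣J∣ : ∀ {n} (J : Subset n) → n ≡ ∣ ∁ J ∣ ℕ.+ ∣ J ∣
n≡∣∁J∣+∣J∣ {n} J = trans (sym (ℕₚ.m∸n+n≡m (∣p∣≤n J))) (cong (ℕ._+ ∣ J ∣) (sym (∣∁p∣≡n∸∣p∣ J)))

0<* : ∀ {p q} → 0ℚ < p → 0ℚ < q → 0ℚ < p * q
0<* {p} {q} 0<p 0<q = ℚₚ.positive⁻¹ (p * q) {{ℚₚ.pos*pos⇒pos p {{ℚ.positive 0<p}} q {{ℚ.positive 0<q}}}}

a<εX∧HX≤1⇒aH<ε : ∀ {a H X ε} → 1ℚ ≤ X → 0ℚ ≤ a → H * X ≤ 1ℚ → a < ε * X → a * H < ε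
a<εX∧HX≤1⇒aH<ε {a} {H} {X} {ε} 1≤X 0≤a HX≤1 a<εX = ℚₚ.*-cancelʳ-<-nonNeg X {{ℚ.nonNegative (ℚₚ.≤-trans 0≤1 1≤X)}} (begin-strict
  a * H * X     ≡⟨ ℚₚ.*-assoc a H X ⟩
  a * (H * X)   ≤⟨ *-monoˡ-≤-≥0 0≤a HX≤1 ⟩
  a * 1ℚ        ≡⟨ ℚₚ.*-identityʳ a ⟩
  a             <⟨ a<εX ⟩
  ε * X         ∎)
  where open ℚₚ.≤-Reasoning

fF-restriction-deviation : ∀ {ε q} k {n} (F : Subset n → Bool) (J y : Subset n) →
  0ℚ < ε → ε ≤ q → q < 1ℚ → ε * toℚ ∣ J ∣ ≤ 1ℚ + 1ℚ → toℚ k < ε * ε * ε * ⅛ * toℚ n →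
  ℚ.∣ μRestr q J y (fF k F) - μ q (fF k F) ∣ < ε
fF-restriction-deviation {ε} {q} k F J y 0<ε ε≤q q<1 εj≤2 k<δn = begin-strict
  ℚ.∣ μRestr q J y (fF k F) - μ q (fF k F) ∣         ≤⟨ μRestr-deviation 0≤q q≤1 J y (fF k F) W-antitone (fF-influence k F) ⟩
  j * μRestr q J ⊥ (λ x → toℚ k * 1/[1+ ∣ x ∣ ])     ≡⟨ cong (j *_) (trans (μRestr-cong J ⊥ +0) (μRestr-*ˡ J ⊥ (toℚ k) _)) ⟩
  j * (toℚ k * H)                                   ≡⟨ ℚₚ.*-assoc j (toℚ k) H ⟨
  j * toℚ k * H                                     <⟨ a<εX∧HX≤1⇒aH<ε 1≤X (0≤* (0≤toℚ ∣ J ∣) (0≤toℚ k))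
                                                         (μRestr-harmonic 0≤q q≤1 J 0)
                                                         (j*k<ε*[q/2*N+1] 0<ε ε≤q (0≤toℚ k) (0≤toℚ ∣ ∁ J ∣) εj≤2 k<δ[N+j]) ⟩
  ε                                                 ∎
  where
  open ℚₚ.≤-Reasoning
  0≤q = ℚₚ.≤-trans (ℚₚ.<⇒≤ 0<ε) ε≤q
  q≤1 = ℚₚ.<⇒≤ q<1
  j = toℚ ∣ J ∣
  N = toℚ ∣ ∁ J ∣
  H = μRestr q J ⊥ (λ x → 1/[1+ ∣ x ∣ ℕ.+ 0 ])
  W-antitone : Antitone (λ m → toℚ k * 1/[1+ m ])
  W-antitone m = *-monoˡ-≤-≥0 (0≤toℚ k) (1/[1+]-antimono (ℕₚ.n≤1+n m))
  +0 : ∀ x → toℚ k * 1/[1+ ∣ x ∣ ] ≡ toℚ k * 1/[1+ ∣ x ∣ ℕ.+ 0 ]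
  +0 x = cong (λ m → toℚ k * 1/[1+ m ]) (sym (ℕₚ.+-identityʳ ∣ x ∣))
  1≤X : 1ℚ ≤ q * ½ * N + 1ℚ
  1≤X = subst (_≤ q * ½ * N + 1ℚ) (ℚₚ.+-identityˡ 1ℚ) (ℚₚ.+-monoˡ-≤ 1ℚ (0≤* (0≤* 0≤q 0≤½) (0≤toℚ ∣ ∁ J ∣)))
  k<δ[N+j] : toℚ k < ε * ε * ε * ⅛ * (N + j)
  k<δ[N+j] = subst (λ t → toℚ k < ε * ε * ε * ⅛ * t) (trans (cong toℚ (n≡∣∁J∣+∣J∣ J)) (toℚ-+ ∣ ∁ J ∣ ∣ J ∣)) k<δn

lemma6p9 : (ε : ℚ) → .{{_ : Positive ε}} →
    Σ ℚ λ δ → Positive δ ×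
      ((k n : ℕ) → .{{_ : NonZero n}} → (+ k) / n < δ →
       (q : ℚ) → ε ≤ q → q < 1ℚ →
       (F : Subset n → Bool) → IsFamily n k F →
       Regular (ceiling ((1/ ε) {{pos⇒nonZero ε}})) ε q (fF k F))
lemma6p9 ε = ε * ε * ε * ⅛ , ℚ.positive (0<* (0<* (0<* 0<ε 0<ε) 0<ε) (ℚₚ.positive⁻¹ ⅛)) ,
  -- fF counts only the k-subsets in F.
  λ k n k/n<δ q ε≤q q<1 F _ J ∣J∣≤⌈1/ε⌉ y →
    fF-restriction-deviation k F J y 0<ε ε≤q q<1
      (ℚₚ.≤-trans (ε*j≤1+ε 0<ε ∣ J ∣ ∣J∣≤⌈1/ε⌉) (ℚₚ.+-monoʳ-≤ 1ℚ (ℚₚ.<⇒≤ (ℚₚ.≤-<-trans ε≤q q<1))))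
      (k/n<δ⇒k<δ*n k n k/n<δ)
  where
  0<ε = ℚₚ.positive⁻¹ ε
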